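{- For every finite graph $G$, $\dim^\circ(G)\le 3\,\mathrm{col}_2(G)$.
   Context: Graphs are finite and simple. A circular-arc graph is the intersection graph of a family of arcs of a circle. The circular dimension $\dim^\circ(G)$ is the minimum $k$ such that $G$ is the intersection (same vertex set, intersection of edge sets) of $k$ circular-arc graphs. For a linear order $\pi$ on $V(G)$ and integer $r\ge 0$, a vertex $u$ is strongly $r$-reachable from $v$ if there is a path $P$ of length at most $r$ between $u$ and $v$ such that $u\le_\pi x$ for all vertices $x$ of $P$ and $v\le_\pi x$ for all vertices $x$ of $P$ other than $u$. The strong $2$-coloring number $\mathrm{col}_2(G)$ is the minimum over linear orders $\pi$ of $V(G)$ of the maximum over vertices $v$ of the number of vertices strongly $2$-reachable from $v$ (including $v$ itself). -}

module Defs where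

open import Data.Nat using (ℕ; zero; suc; _+_; _∸_; _≤_; _*_)
open import Data.Nat.DivMod using (_%_)
open import Data.Fin using (Fin; toℕ)
open import Data.Bool using (Bool; true; false)
open import Data.List using (List; length)
open import Data.List.Relation.Unary.All using (All)
open import Data.List.Relation.Unary.Unique.Propositional using (Unique)
open import Data.Product using (Σ; ∃; ∃-syntax; _×_)
open import Relation.Binary.PropositionalEquality using (_≡_; _≢_)
open import Function.Definitions using (Injective)
open import Function.Bundles using (_⇔_)

record Graph (n : ℕ) : Set where
  field
    adj   : Fin n → Fin n → Bool
    sym   : ∀ u v → adj u v ≡ adj v u
    irrfl : ∀ v → adj v v ≡ false

open Graph public

Edge : ∀ {n} → Graph n → Fin n → Fin n → Set
Edge G u v = adj G u v ≡ true

-- Since only finitely many arcs occur, the circle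
-- is discretised as the cyclic set of points Fin (suc m) (Z / (suc m)).
-- An arc is given by a start point s and a length ℓ; it consists of the
-- points s, s+1, ..., s+ℓ (mod suc m).  (ℓ ≥ m gives the whole circle.)

record Arc (m : ℕ) : Set where
  constructor arc
  field
    start  : Fin (suc m)
    len    : ℕ

open Arc public

_∈Arc_ : ∀ {m} → Fin (suc m) → Arc m → Set
_∈Arc_ {m} p a = ((toℕ p + suc m) ∸ toℕ (start a)) % suc m ≤ len a

ArcsMeet : ∀ {m} → Arc m → Arc m → Set
ArcsMeet {m} a b = ∃[ p ] (p ∈Arc a × p ∈Arc b)

IsCircularArc : ∀ {n} → Graph n → Set
IsCircularArc {n} H =
  ∃[ m ] Σ (Fin n → Arc m) λ A →
    ∀ u v → u ≢ v → (Edge H u v ⇔ ArcsMeet (A u) (A v))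

IsIntersectionOfCA : ∀ {n} → Graph n → ℕ → Set
IsIntersectionOfCA {n} G k =
  Σ (Fin k → Graph n) λ H →
    (∀ i → IsCircularArc (H i)) ×
    (∀ u v → (Edge G u v ⇔ (∀ i → Edge (H i) u v)))

IsCircDim : ∀ {n} → Graph n → ℕ → Set
IsCircDim G d = IsIntersectionOfCA G d × (∀ k → IsIntersectionOfCA G k → d ≤ k)

record LinOrder (n : ℕ) : Set where
  field
    rank    : Fin n → Fin n
    rankInj : Injective _≡_ _≡_ rank

open LinOrder public

_≤[_]_ : ∀ {n} → Fin n → LinOrder n → Fin n → Set
u ≤[ π ] x = toℕ (rank π u) ≤ toℕ (rank π x)

data SReach2 {n} (G : Graph n) (π : LinOrder n) (v : Fin n) : Fin n → Set where
  len0 : SReach2 G π v v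
  len1 : ∀ {u} → Edge G u v → u ≤[ π ] v → SReach2 G π v u
  len2 : ∀ {u} w → u ≢ v → w ≢ u → w ≢ v →
         Edge G u w → Edge G w v →
         u ≤[ π ] w → u ≤[ π ] v → v ≤[ π ] w →
         SReach2 G π v u

CardAtMost : ∀ {n} → (Fin n → Set) → ℕ → Set
CardAtMost {n} P c = ∀ (xs : List (Fin n)) → Unique xs → All P xs → length xs ≤ c

Col2AtMost : ∀ {n} → Graph n → ℕ → Set
Col2AtMost {n} G c = ∃[ π ] (∀ (v : Fin n) → CardAtMost (SReach2 G π v) c)

IsCol2 : ∀ {n} → Graph n → ℕ → Set
IsCol2 G c = Col2AtMost G c × (∀ c' → Col2AtMost G c' → c ≤ c')

-- Colour the vertices greedily along an order π witnessing col₂(G) ≤ c, so that vertices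
-- strongly 2-reachable from one another get distinct colours among c.  Then adjacent vertices,
-- and any two earlier neighbours of a common vertex, get distinct colours.
-- For each colour i build two circular-arc graphs on a circle consisting of a point ∞ followed
-- by the vertices in π-order: a vertex of colour i is a single point; any other vertex y is the
-- arc from y round to ∞, unless y has an earlier neighbour e of colour i (then unique), in which
-- case it is the arc from e to ∞ in the first graph and the arc from y over ∞ to e in the second.
-- Adjacent vertices meet in all these graphs, while for non-adjacent u before v one of the two
-- graphs of the colour of u separates them; so G is the intersection of 2c circular-arc graphs.

module Submission where

open import Defs hiding (sym)
open import Data.Nat using (ℕ; zero; suc; _+_; _∸_; _≤_; _<_; _*_; z≤n; s≤s; s≤s⁻¹; z<s)
open import Data.Nat.Properties
open import Data.Nat.DivMod using (_%_; m<n⇒m%n≡m; [m+n]%n≡m%n)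
open import Data.Fin as Fin using (Fin; toℕ; fromℕ<; splitAt; _↑ˡ_; _↑ʳ_)
open import Data.Fin.Properties using (toℕ<n; toℕ-injective; any?; splitAt-↑ˡ; splitAt-↑ʳ)
open import Data.Sum using (_⊎_; inj₁; inj₂; [_,_]′)
open import Data.Product using (∃; _×_; _,_; ∃-syntax; proj₁; proj₂; uncurry)
open import Data.Bool using (Bool; true; false)
open import Data.List using (tabulate; []; _∷_)
open import Data.List.Relation.Unary.All using ([]; _∷_)
open import Data.List.Relation.Unary.AllPairs using ([]; _∷_)
open import Data.Vec.Functional using (updateAt)
open import Data.Vec.Functional.Properties using (updateAt-updates; updateAt-minimal)
open import Data.List.Properties using (length-tabulate)
import Data.List.Relation.Unary.All.Properties as All
import Data.List.Relation.Unary.Unique.Propositional.Properties as Unique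
open import Relation.Nullary using (¬_; Dec; does; contradiction; yes; no; _×-dec_; ¬?)
open import Relation.Nullary.Decidable using (dec-false; does-⇔; decidable-stable)
open import Relation.Binary using (Decidable; Symmetric)
open import Relation.Binary.PropositionalEquality
  using (_≡_; _≢_; refl; cong; sym; trans; subst; subst₂; module ≡-Reasoning)
open import Function using (_∘_)
open import Function.Bundles using (_⇔_; mk⇔; Equivalence)

module _ {m : ℕ} where

  point : Fin (suc m) → Arc m
  point s = arc s 0

  wrap : Fin (suc m) → Fin (suc m) → Arc m
  wrap s e = arc s (suc m ∸ toℕ s + toℕ e)

  private
    offset-≥ : ∀ (p s : Fin (suc m)) → toℕ s ≤ toℕ p →
               (toℕ p + suc m ∸ toℕ s) % suc m ≡ toℕ p ∸ toℕ s
    offset-≥ p s s≤p = begin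
      (toℕ p + suc m ∸ toℕ s) % suc m  ≡⟨ cong (_% suc m) (+-∸-comm (suc m) s≤p) ⟩
      (toℕ p ∸ toℕ s + suc m) % suc m  ≡⟨ [m+n]%n≡m%n (toℕ p ∸ toℕ s) (suc m) ⟩
      (toℕ p ∸ toℕ s) % suc m          ≡⟨ m<n⇒m%n≡m (≤-<-trans (m∸n≤m _ (toℕ s)) (toℕ<n p)) ⟩
      toℕ p ∸ toℕ s                    ∎
      where open ≡-Reasoning

    offset-< : ∀ (p s : Fin (suc m)) → toℕ p < toℕ s →
               (toℕ p + suc m ∸ toℕ s) % suc m ≡ (suc m ∸ toℕ s) + toℕ p
    offset-< p s p<s = begin
      (toℕ p + suc m ∸ toℕ s) % suc m  ≡⟨ m<n⇒m%n≡m p+m+1∸s<m+1 ⟩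
      toℕ p + suc m ∸ toℕ s            ≡⟨ +-∸-assoc (toℕ p) (<⇒≤ (toℕ<n s)) ⟩
      toℕ p + (suc m ∸ toℕ s)          ≡⟨ +-comm (toℕ p) (suc m ∸ toℕ s) ⟩
      (suc m ∸ toℕ s) + toℕ p          ∎
      where
      open ≡-Reasoning
      p+m+1∸s<m+1 : toℕ p + suc m ∸ toℕ s < suc m
      p+m+1∸s<m+1 = m<n+o⇒m∸n<o (toℕ p + suc m) (toℕ s) (+-monoˡ-< (suc m) p<s)

  ∈-point : ∀ (p s : Fin (suc m)) → p ∈Arc point s ⇔ p ≡ s
  ∈-point p s with ≤-<-connex (toℕ s) (toℕ p)
  ... | inj₁ s≤p rewrite offset-≥ p s s≤p =
    mk⇔ (λ p∸s≤0 → toℕ-injective (≤-antisym (m∸n≡0⇒m≤n (n≤0⇒n≡0 p∸s≤0)) s≤p))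
        (λ { refl → ≤-reflexive (n∸n≡0 (toℕ p)) })
  ... | inj₂ p<s rewrite offset-< p s p<s =
    mk⇔ (λ le → contradiction (≤-trans (m≤m+n (suc m ∸ toℕ s) (toℕ p)) le)
                              (<⇒≱ (m<n⇒0<n∸m (toℕ<n s))))
        (λ { refl → contradiction p<s (<-irrefl refl) })

  ∈-wrap : ∀ (p s e : Fin (suc m)) → p ∈Arc wrap s e ⇔ (toℕ s ≤ toℕ p ⊎ toℕ p ≤ toℕ e)
  ∈-wrap p s e with ≤-<-connex (toℕ s) (toℕ p)
  ... | inj₁ s≤p rewrite offset-≥ p s s≤p =
    mk⇔ (λ _ → inj₁ s≤p)
        (λ _ → ≤-trans (∸-monoˡ-≤ (toℕ s) (<⇒≤ (toℕ<n p))) (m≤m+n (suc m ∸ toℕ s) (toℕ e)))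
  ... | inj₂ p<s rewrite offset-< p s p<s =
    mk⇔ (inj₂ ∘ +-cancelˡ-≤ (suc m ∸ toℕ s) (toℕ p) (toℕ e))
        (λ { (inj₁ s≤p) → contradiction s≤p (<⇒≱ p<s)
           ; (inj₂ p≤e) → +-monoʳ-≤ (suc m ∸ toℕ s) p≤e })

  meet-point : ∀ (s : Fin (suc m)) (a : Arc m) → ArcsMeet (point s) a ⇔ s ∈Arc a
  meet-point s a =
    mk⇔ (λ (p , p∈s , p∈a) → subst (_∈Arc a) (Equivalence.to (∈-point p s) p∈s) p∈a)
        (λ s∈a → s , Equivalence.from (∈-point s s) refl , s∈a)

  outside-wrap : ∀ (p s e : Fin (suc m)) → toℕ p < toℕ s → toℕ e < toℕ p → ¬ p ∈Arc wrap s e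
  outside-wrap p s e p<s e<p p∈ with Equivalence.to (∈-wrap p s e) p∈
  ... | inj₁ s≤p = <⇒≱ p<s s≤p
  ... | inj₂ p≤e = <⇒≱ e<p p≤e

  ArcsMeet-sym : ∀ (a b : Arc m) → ArcsMeet a b → ArcsMeet b a
  ArcsMeet-sym _ _ (p , p∈a , p∈b) = p , p∈b , p∈a

  _∈Arc?_ : ∀ (p : Fin (suc m)) (a : Arc m) → Dec (p ∈Arc a)
  p ∈Arc? a = _ ≤? len a

  ArcsMeet? : ∀ (a b : Arc m) → Dec (ArcsMeet a b)
  ArcsMeet? a b = any? (λ p → p ∈Arc? a ×-dec p ∈Arc? b)

does≡true⇔ : ∀ {A : Set} (a? : Dec A) → does a? ≡ true ⇔ A
does≡true⇔ (yes a) = mk⇔ (λ _ → a) (λ _ → refl)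
does≡true⇔ (no ¬a) = mk⇔ (λ ()) (λ a → contradiction a ¬a)

module _ {n : ℕ} (R : Fin n → Fin n → Set) (R? : Decidable R)
         (R-sym : Symmetric R) (R-irrefl : ∀ v → ¬ R v v) where

  graphOf : Graph n
  graphOf = record
    { adj   = λ u v → does (R? u v)
    ; sym   = λ u v → does-⇔ (mk⇔ R-sym R-sym) (R? u v) (R? v u)
    ; irrfl = λ v → dec-false (R? v v) (R-irrefl v)
    }

  Edge-graphOf : ∀ {u v} → Edge graphOf u v ⇔ R u v
  Edge-graphOf {u} {v} = does≡true⇔ (R? u v)

module _ {n m : ℕ} (A : Fin n → Arc m) where

  Overlap : Fin n → Fin n → Set
  Overlap u v = u ≢ v × ArcsMeet (A u) (A v)

  private
    overlap? : Decidable Overlap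
    overlap? u v = ¬? (u Fin.≟ v) ×-dec ArcsMeet? (A u) (A v)

    overlap-sym : Symmetric Overlap
    overlap-sym {u} {v} (u≢v , meet) = u≢v ∘ sym , ArcsMeet-sym (A u) (A v) meet

    overlap-irrefl : ∀ v → ¬ Overlap v v
    overlap-irrefl v (v≢v , _) = v≢v refl

  intersectionGraph : Graph n
  intersectionGraph = graphOf Overlap overlap? overlap-sym overlap-irrefl

  Edge-intersectionGraph : ∀ {u v} → Edge intersectionGraph u v ⇔ Overlap u v
  Edge-intersectionGraph = Edge-graphOf Overlap overlap? overlap-sym overlap-irrefl

  intersectionGraph-isCircularArc : IsCircularArc intersectionGraph
  intersectionGraph-isCircularArc = m , A , λ u v u≢v →
    mk⇔ (proj₂ ∘ Equivalence.to Edge-intersectionGraph)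
        (λ meet → Equivalence.from Edge-intersectionGraph (u≢v , meet))

intersection-of-pairs : ∀ {n k} {G : Graph n} (H : Fin k → Bool → Graph n) →
  (∀ i b → IsCircularArc (H i b)) →
  (∀ u v → Edge G u v ⇔ (∀ i b → Edge (H i b) u v)) →
  IsIntersectionOfCA G (k + k)
intersection-of-pairs {k = k} H H-circular G≡⋂H =
  uncurry H ∘ unpair , uncurry H-circular ∘ unpair , λ u v →
    mk⇔ (λ uv∈G j → Equivalence.to (G≡⋂H u v) uv∈G _ _)
        (λ uv∈H → Equivalence.from (G≡⋂H u v) λ i b →
           subst (λ ib → Edge (uncurry H ib) u v) (unpair-pair i b) (uv∈H (pair i b)))
  where
  unpair : Fin (k + k) → Fin k × Bool
  unpair j = [ (_, true) , (_, false) ]′ (splitAt k j)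

  pair : Fin k → Bool → Fin (k + k)
  pair i true  = i ↑ˡ k
  pair i false = k ↑ʳ i

  unpair-pair : ∀ i b → unpair (pair i b) ≡ (i , b)
  unpair-pair i true  rewrite splitAt-↑ˡ k i k = refl
  unpair-pair i false rewrite splitAt-↑ʳ k k i = refl

module _ {n : ℕ} (G : Graph n) where

  Edge? : Decidable (Edge G)
  Edge? u v = adj G u v Data.Bool.≟ true

  Edge-sym : Symmetric (Edge G)
  Edge-sym {u} {v} uv = trans (Graph.sym G v u) uv

  Edge-irrefl : ∀ {u v} → Edge G u v → u ≢ v
  Edge-irrefl {u} uu refl with trans (sym (irrfl G u)) uu
  ... | ()

_<[_]_ : ∀ {n} → Fin n → LinOrder n → Fin n → Set
u <[ π ] v = toℕ (rank π u) < toℕ (rank π v)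

_≤[_]?_ : ∀ {n} (u : Fin n) (π : LinOrder n) (v : Fin n) → Dec (u ≤[ π ] v)
u ≤[ π ]? v = toℕ (rank π u) ≤? toℕ (rank π v)

module _ {n : ℕ} (π : LinOrder n) where

  rank-injective : ∀ {u v} → toℕ (rank π u) ≡ toℕ (rank π v) → u ≡ v
  rank-injective = rankInj π ∘ toℕ-injective

  ≤π∧≢⇒<π : ∀ {u v} → u ≤[ π ] v → u ≢ v → u <[ π ] v
  ≤π∧≢⇒<π u≤v u≢v = ≤∧≢⇒< u≤v (u≢v ∘ rank-injective)

  <π-connex : ∀ {u v} → u ≢ v → u <[ π ] v ⊎ v <[ π ] u
  <π-connex {u} {v} u≢v with ≤-total (toℕ (rank π u)) (toℕ (rank π v))
  ... | inj₁ u≤v = inj₁ (≤π∧≢⇒<π u≤v u≢v)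
  ... | inj₂ v≤u = inj₂ (≤π∧≢⇒<π v≤u (u≢v ∘ sym))

  wlog-<π : {P : Fin n → Fin n → Set} → Symmetric P →
            (∀ {u v} → u <[ π ] v → P u v) → ∀ {u v} → u ≢ v → P u v
  wlog-<π P-sym P-< u≢v with <π-connex u≢v
  ... | inj₁ u<v = P-< u<v
  ... | inj₂ v<u = P-sym (P-< v<u)

CardAtMost⇒no-injection : ∀ {n c} {P : Fin n → Set} → CardAtMost P c →
  (g : Fin (suc c) → Fin n) → (∀ {i j} → g i ≡ g j → i ≡ j) → ¬ (∀ j → P (g j))
CardAtMost⇒no-injection {c = c} P≤c g g-injective P∘g =
  <-irrefl refl (subst (_≤ c) (length-tabulate g)
                  (P≤c (tabulate g) (Unique.tabulate⁺ g-injective) (All.tabulate⁺ P∘g)))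

module GreedyColouring {n c : ℕ} (π : LinOrder n)
  (R : Fin n → Fin n → Set) (R? : Decidable R) (R-refl : ∀ v → R v v)
  (R-≤ : ∀ {v u} → R v u → u ≤[ π ] v) (R-bounded : ∀ v → CardAtMost (R v) c)
  where

  private
    Used : (Fin n → Fin c) → Fin n → Fin c → Set
    Used f v j = ∃[ u ] (u ≢ v × R v u × f u ≡ j)

    used? : ∀ f v j → Dec (Used f v j)
    used? f v j = any? (λ u → ¬? (u Fin.≟ v) ×-dec R? v u ×-dec f u Fin.≟ j)

  unused-colour : (f : Fin n → Fin c) (v : Fin n) → ∃[ j ] (∀ {u} → u ≢ v → R v u → f u ≢ j)
  unused-colour f v with any? (¬? ∘ used? f v)
  ... | yes (j , unused) = j , λ u≢v vRu fu≡j → unused (_ , u≢v , vRu , fu≡j)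
  ... | no all-used = contradiction users-reached
                        (CardAtMost⇒no-injection (R-bounded v) users users-injective)
    where
    user : ∀ j → Used f v j
    user j = decidable-stable (used? f v j) (λ unused → all-used (j , unused))

    users : Fin (suc c) → Fin n
    users Fin.zero    = v
    users (Fin.suc j) = proj₁ (user j)

    users-reached : ∀ j → R v (users j)
    users-reached Fin.zero    = R-refl v
    users-reached (Fin.suc j) = let (_ , _ , vRu , _) = user j in vRu

    users-injective : ∀ {i j} → users i ≡ users j → i ≡ j
    users-injective {Fin.zero}  {Fin.zero}  _   = refl
    users-injective {Fin.zero}  {Fin.suc j} v≡u = let (_ , u≢v , _) = user j in contradiction (sym v≡u) u≢v
    users-injective {Fin.suc i} {Fin.zero}  u≡v = let (_ , u≢v , _) = user i in contradiction u≡v u≢v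
    users-injective {Fin.suc i} {Fin.suc j} u≡u′ =
      let (_ , _ , _ , fu≡i) = user i ; (_ , _ , _ , fu′≡j) = user j
      in cong Fin.suc (trans (sym fu≡i) (trans (cong f u≡u′) fu′≡j))

  ProperBelow : ℕ → (Fin n → Fin c) → Set
  ProperBelow k f = ∀ {u v} → toℕ (rank π v) < k → u ≢ v → R v u → f u ≢ f v

  Proper : (Fin n → Fin c) → Set
  Proper f = ∀ {u v} → u ≢ v → R v u → f u ≢ f v

  -- A vertex v shows that c ≠ 0, since R v v.
  constant-colouring : Fin n → Fin c
  constant-colouring v = fromℕ< (R-bounded v (v ∷ []) ([] ∷ []) (R-refl v ∷ []))

  recolour-next : ∀ {k f v j} → ProperBelow k f → toℕ (rank π v) ≡ k →
    (∀ {u} → u ≢ v → R v u → f u ≢ j) → ProperBelow (suc k) (updateAt f v (λ _ → j))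
  recolour-next {k} {f} {v} {j} f-proper v≡k j-unused {u} {w} w<1+k u≢w wRu with w Fin.≟ v
  ... | yes refl = subst₂ _≢_ (sym (updateAt-minimal u v f u≢w)) (sym (updateAt-updates v f))
                      (j-unused u≢w wRu)
  ... | no w≢v   = subst₂ _≢_ (sym (updateAt-minimal u v f u≢v)) (sym (updateAt-minimal w v f w≢v))
                      (f-proper w<k u≢w wRu)
    where
    w<k : toℕ (rank π w) < k
    w<k = ≤∧≢⇒< (s≤s⁻¹ w<1+k) (λ w≡k → w≢v (rank-injective π (trans w≡k (sym v≡k))))

    u≢v : u ≢ v
    u≢v refl = <⇒≱ w<k (≤-trans (≤-reflexive (sym v≡k)) (R-≤ wRu))

  properBelow : ∀ k → ∃ (ProperBelow k)
  properBelow zero = constant-colouring , λ ()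
  properBelow (suc k) with properBelow k | any? (λ v → toℕ (rank π v) ≟ k)
  ... | f , f-proper | no no-rank-k =
    f , λ v<1+k → f-proper (≤∧≢⇒< (s≤s⁻¹ v<1+k) (λ v≡k → no-rank-k (_ , v≡k)))
  ... | f , f-proper | yes (v , v≡k) =
    let (j , j-unused) = unused-colour f v in _ , recolour-next f-proper v≡k j-unused

  colouring : ∃ Proper
  colouring = let (f , f-proper) = properBelow n in f , f-proper (toℕ<n _)

module _ {n : ℕ} (G : Graph n) (π : LinOrder n) where

  SReach2-≤ : ∀ {v u} → SReach2 G π v u → u ≤[ π ] v
  SReach2-≤ len0                          = ≤-refl
  SReach2-≤ (len1 _ u≤v)                  = u≤v
  SReach2-≤ (len2 _ _ _ _ _ _ _ u≤v _)    = u≤v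

  SReach2? : Decidable (SReach2 G π)
  SReach2? v u with u Fin.≟ v
  ... | yes refl = yes len0
  ... | no u≢v with Edge? G u v ×-dec u ≤[ π ]? v
  ...   | yes (uv , u≤v) = yes (len1 uv u≤v)
  ...   | no ¬len1 with any? (λ w → ¬? (w Fin.≟ u) ×-dec ¬? (w Fin.≟ v)
                                    ×-dec Edge? G u w ×-dec Edge? G w v
                                    ×-dec u ≤[ π ]? w ×-dec u ≤[ π ]? v ×-dec v ≤[ π ]? w)
  ...     | yes (w , w≢u , w≢v , uw , wv , u≤w , u≤v , v≤w) =
    yes (len2 w u≢v w≢u w≢v uw wv u≤w u≤v v≤w)
  ...     | no ¬len2 = no λ
    { len0 → u≢v refl
    ; (len1 uv u≤v) → ¬len1 (uv , u≤v)
    ; (len2 w _ w≢u w≢v uw wv u≤w u≤v v≤w) → ¬len2 (w , w≢u , w≢v , uw , wv , u≤w , u≤v , v≤w)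
    }

record EarlierDistinctColouring {n} (G : Graph n) (π : LinOrder n) (k : ℕ) : Set where
  field
    colour            : Fin n → Fin k
    proper            : ∀ {u v} → Edge G u v → colour u ≢ colour v
    earlier-injective : ∀ {x x′ y} → Edge G x y → Edge G x′ y → x <[ π ] y → x′ <[ π ] y →
                        colour x ≡ colour x′ → x ≡ x′

earlierDistinctColouring : ∀ {n c} (G : Graph n) (π : LinOrder n) →
  (∀ v → CardAtMost (SReach2 G π v) c) → EarlierDistinctColouring G π c
earlierDistinctColouring {n} {c} G π bounded = record
  { colour            = colour
  ; proper            = λ uv → wlog-<π π proper-sym proper-< (Edge-irrefl G uv) uv
  ; earlier-injective = earlier-injective
  }
  where
  open GreedyColouring π (SReach2 G π) (SReach2? G π) (λ _ → len0) (SReach2-≤ G π) bounded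

  colour : Fin n → Fin c
  colour = proj₁ colouring

  reach-distinct : Proper colour
  reach-distinct = proj₂ colouring

  ProperAt : Fin n → Fin n → Set
  ProperAt u v = Edge G u v → colour u ≢ colour v

  proper-sym : Symmetric ProperAt
  proper-sym uv⇒≢ vu = uv⇒≢ (Edge-sym G vu) ∘ sym

  proper-< : ∀ {u v} → u <[ π ] v → ProperAt u v
  proper-< u<v uv = reach-distinct (Edge-irrefl G uv) (len1 uv (<⇒≤ u<v))

  EarlierDistinct : Fin n → Fin n → Set
  EarlierDistinct x x′ =
    ∀ {y} → Edge G x y → Edge G x′ y → x <[ π ] y → x′ <[ π ] y → colour x ≢ colour x′

  earlier-distinct-sym : Symmetric EarlierDistinct
  earlier-distinct-sym xx′-distinct x′y xy x′<y x<y = xx′-distinct xy x′y x<y x′<y ∘ sym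

  earlier-distinct-< : ∀ {x x′} → x <[ π ] x′ → EarlierDistinct x x′
  earlier-distinct-< {x} {x′} x<x′ xy x′y x<y x′<y = reach-distinct x≢x′
    (len2 _ x≢x′ (Edge-irrefl G xy ∘ sym) (Edge-irrefl G x′y ∘ sym) xy (Edge-sym G x′y)
          (<⇒≤ x<y) (<⇒≤ x<x′) (<⇒≤ x′<y))
    where
    x≢x′ : x ≢ x′
    x≢x′ refl = <-irrefl refl x<x′

  earlier-injective : ∀ {x x′ y} → Edge G x y → Edge G x′ y → x <[ π ] y → x′ <[ π ] y →
                      colour x ≡ colour x′ → x ≡ x′
  earlier-injective {x} {x′} xy x′y x<y x′<y same with x Fin.≟ x′
  ... | yes x≡x′ = x≡x′
  ... | no x≢x′ =
    contradiction same (wlog-<π π earlier-distinct-sym earlier-distinct-< x≢x′ xy x′y x<y x′<y)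

module ArcModel {n k} {G : Graph n} {π : LinOrder n} (χ : EarlierDistinctColouring G π k) where
  open EarlierDistinctColouring χ

  pos : Fin n → Fin (suc n)
  pos v = Fin.suc (rank π v)

  ∞ : Fin (suc n)
  ∞ = Fin.zero

  EarlierNeighbour : Fin k → Fin n → Fin n → Set
  EarlierNeighbour i y e = colour e ≡ i × Edge G e y × e <[ π ] y

  data Situation (i : Fin k) (y : Fin n) : Set where
    coloured : colour y ≡ i → Situation i y
    lonely   : colour y ≢ i → (∀ e → ¬ EarlierNeighbour i y e) → Situation i y
    attached : colour y ≢ i → ∀ e → EarlierNeighbour i y e → Situation i y

  -- Opaque, so that case splits on colour y ≟ i in the proofs below do not unfold arcs.
  opaque
    situation : ∀ i y → Situation i y
    situation i y with colour y Fin.≟ i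
    ... | yes yi = coloured yi
    ... | no y≢i with any? (λ e → colour e Fin.≟ i ×-dec Edge? G e y
                                  ×-dec toℕ (rank π e) <? toℕ (rank π y))
    ...   | no none             = lonely y≢i (λ e e-earlier → none (e , e-earlier))
    ...   | yes (e , e-earlier) = attached y≢i e e-earlier

  arcOf : ∀ {i y} → Situation i y → Bool → Arc n
  arcOf {y = y} (coloured _)       _     = point (pos y)
  arcOf {y = y} (lonely _ _)       _     = wrap (pos y) ∞
  arcOf         (attached _ e _)   true  = wrap (pos e) ∞
  arcOf {y = y} (attached _ e _)   false = wrap (pos y) (pos e)

  arcs : Fin k → Bool → Fin n → Arc n
  arcs i b y = arcOf (situation i y) b

  meet-coloured : ∀ {i x} b a → colour x ≡ i → ArcsMeet (arcs i b x) a ⇔ pos x ∈Arc a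
  meet-coloured {i} {x} b a xi with situation i x
  ... | coloured _   = meet-point (pos x) a
  ... | lonely x≢i _ = contradiction xi x≢i
  ... | attached x≢i _ _ = contradiction xi x≢i

  ∞∈arcs : ∀ {i y} b → colour y ≢ i → ∞ ∈Arc arcs i b y
  ∞∈arcs {i} {y} b y≢i with situation i y | b
  ... | coloured yi       | _     = contradiction yi y≢i
  ... | lonely _ _        | _     = Equivalence.from (∈-wrap ∞ (pos y) ∞) (inj₂ z≤n)
  ... | attached _ e _    | true  = Equivalence.from (∈-wrap ∞ (pos e) ∞) (inj₂ z≤n)
  ... | attached _ e _    | false = Equivalence.from (∈-wrap ∞ (pos y) (pos e)) (inj₂ z≤n)

  neighbour∈arcs : ∀ {i x y} b → Edge G x y → colour x ≡ i → pos x ∈Arc arcs i b y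
  neighbour∈arcs {i} {x} {y} b xy xi with situation i y | <π-connex π (Edge-irrefl G xy) | b
  ... | coloured yi | _ | _ = contradiction (trans xi (sym yi)) (proper xy)
  ... | lonely _ none | inj₁ x<y | _ = contradiction (xi , xy , x<y) (none x)
  ... | lonely _ _ | inj₂ y<x | _ =
    Equivalence.from (∈-wrap (pos x) (pos y) ∞) (inj₁ (s≤s (<⇒≤ y<x)))
  ... | attached _ e (_ , _ , e<y) | inj₂ y<x | true =
    Equivalence.from (∈-wrap (pos x) (pos e) ∞) (inj₁ (s≤s (<⇒≤ (<-trans e<y y<x))))
  ... | attached _ e _ | inj₂ y<x | false =
    Equivalence.from (∈-wrap (pos x) (pos y) (pos e)) (inj₁ (s≤s (<⇒≤ y<x)))
  ... | attached _ e (ei , ey , e<y) | inj₁ x<y | b′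
    with earlier-injective xy ey x<y e<y (trans xi (sym ei)) | b′
  ...   | refl | true  = Equivalence.from (∈-wrap (pos x) (pos x) ∞) (inj₁ ≤-refl)
  ...   | refl | false = Equivalence.from (∈-wrap (pos x) (pos y) (pos x)) (inj₂ ≤-refl)

  edge⇒meet : ∀ {u v} → Edge G u v → ∀ i b → ArcsMeet (arcs i b u) (arcs i b v)
  edge⇒meet {u} {v} uv i b with colour u Fin.≟ i | colour v Fin.≟ i
  ... | yes ui | yes vi = contradiction (trans ui (sym vi)) (proper uv)
  ... | yes ui | no _   =
    Equivalence.from (meet-coloured b (arcs i b v) ui) (neighbour∈arcs b uv ui)
  ... | no _   | yes vi = ArcsMeet-sym (arcs i b v) (arcs i b u)
    (Equivalence.from (meet-coloured b (arcs i b u) vi) (neighbour∈arcs b (Edge-sym G uv) vi))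
  ... | no u≢i | no v≢i = ∞ , ∞∈arcs b u≢i , ∞∈arcs b v≢i

  nonEdge⇒apart : ∀ {u v} → ¬ Edge G u v → u <[ π ] v → ∃[ b ] ¬ pos u ∈Arc arcs (colour u) b v
  nonEdge⇒apart {u} {v} ¬uv u<v with situation (colour u) v
  ... | coloured _ = true , λ u∈v →
    <-irrefl (suc-injective (cong toℕ (Equivalence.to (∈-point (pos u) (pos v)) u∈v))) u<v
  ... | lonely _ _ = true , outside-wrap (pos u) (pos v) ∞ (s≤s u<v) z<s
  ... | attached _ e (_ , ev , e<v) with <π-connex π e≢u
    where
    e≢u : e ≢ u
    e≢u refl = ¬uv ev
  ...   | inj₁ e<u = false , outside-wrap (pos u) (pos v) (pos e) (s≤s u<v) (s≤s e<u)
  ...   | inj₂ u<e = true , outside-wrap (pos u) (pos e) ∞ (s≤s u<e) z<s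

  MeetEverywhere : Fin n → Fin n → Set
  MeetEverywhere u v = ∀ i b → ArcsMeet (arcs i b u) (arcs i b v)

  meet⇒edge : ∀ {u v} → u ≢ v → MeetEverywhere u v → Edge G u v
  meet⇒edge = wlog-<π π meet⇒edge-sym meet⇒edge-<
    where
    meet⇒edge-sym : Symmetric (λ u v → MeetEverywhere u v → Edge G u v)
    meet⇒edge-sym {u} {v} uv-meet⇒edge vu-meet = Edge-sym G (uv-meet⇒edge λ i b →
      ArcsMeet-sym (arcs i b v) (arcs i b u) (vu-meet i b))

    meet⇒edge-< : ∀ {u v} → u <[ π ] v → MeetEverywhere u v → Edge G u v
    meet⇒edge-< {u} {v} u<v meet = decidable-stable (Edge? G u v) λ ¬uv →
      let (b , apart) = nonEdge⇒apart ¬uv u<v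
      in apart (Equivalence.to (meet-coloured b (arcs (colour u) b v) refl) (meet (colour u) b))

  layer : Fin k → Bool → Graph n
  layer i b = intersectionGraph (arcs i b)

  G≡⋂layers : ∀ u v → Edge G u v ⇔ (∀ i b → Edge (layer i b) u v)
  G≡⋂layers u v = mk⇔
    (λ uv i b → Equivalence.from (Edge-intersectionGraph (arcs i b)) (Edge-irrefl G uv , edge⇒meet uv i b))
    (λ uv∈layers → meet⇒edge (proj₁ (layers⇒overlap uv∈layers (colour u) true))
                             (λ i b → proj₂ (layers⇒overlap uv∈layers i b)))
    where
    layers⇒overlap : (∀ i b → Edge (layer i b) u v) → ∀ i b → Overlap (arcs i b) u v
    layers⇒overlap uv∈layers i b = Equivalence.to (Edge-intersectionGraph (arcs i b)) (uv∈layers i b)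

  isIntersectionOfCA : IsIntersectionOfCA G (k + k)
  isIntersectionOfCA =
    intersection-of-pairs {G = G} layer (λ i b → intersectionGraph-isCircularArc (arcs i b)) G≡⋂layers

Col2AtMost⇒IsIntersectionOfCA : ∀ {n c} {G : Graph n} → Col2AtMost G c → IsIntersectionOfCA G (c + c)
Col2AtMost⇒IsIntersectionOfCA {G = G} (π , bounded) =
  ArcModel.isIntersectionOfCA (earlierDistinctColouring G π bounded)

theorem8 : ∀ (n : ℕ) (G : Graph n) (d c : ℕ) →
    IsCircDim G d → IsCol2 G c → d ≤ 3 * c
theorem8 n G d c (_ , d-minimal) (col₂≤c , _) = begin
  d      ≤⟨ d-minimal (c + c) (Col2AtMost⇒IsIntersectionOfCA col₂≤c) ⟩
  c + c  ≤⟨ +-monoʳ-≤ c (m≤m+n c (c + 0)) ⟩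
  3 * c  ∎
  where open ≤-Reasoning
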